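{- Let $\mathcal{CS}$ be any constant specification and $\mathcal{M}$ the canonical AF-model meeting $\mathcal{CS}$. For all formulae $A$ and all worlds $w\in W$: $A\in w$ if and only if $\mathcal{M},w\Vdash A$.
   Context: Fix a number $h\ge 1$ of agents. Throughout, $i$ ranges over $\{1,\dots,h\}$, $*$ over $\{1,\dots,h,\mathsf{C}\}$, and $\circledast$ over $\{1,\dots,h,\mathsf{E},\mathsf{C}\}$. For each $\circledast$ let $\mathrm{Cons}_\circledast$ (proof constants) and $\mathrm{Var}_\circledast$ (proof variables) be countably infinite sets, all pairwise disjoint. Evidence terms $\mathrm{Tm}_1,\dots,\mathrm{Tm}_h,\mathrm{Tm}_{\mathsf{E}},\mathrm{Tm}_{\mathsf{C}}$ are defined by simultaneous induction: $\mathrm{Cons}_\circledast\cup\mathrm{Var}_\circledast\subseteq\mathrm{Tm}_\circledast$; if $t\in\mathrm{Tm}_i$ then $!_i t\in\mathrm{Tm}_i$; if $t,s\in\mathrm{Tm}_*$ then $t+_*s,\ t\cdot_* s\in\mathrm{Tm}_*$; if $t_1\in\mathrm{Tm}_1,\dots,t_h\in\mathrm{Tm}_h$ then $\langle t_1,\dots,t_h\rangle\in\mathrm{Tm}_{\mathsf{E}}$; if $t\in\mathrm{Tm}_{\mathsf{E}}$ then $\pi_i t\in\mathrm{Tm}_i$; if $t\in\mathrm{Tm}_{\mathsf{C}}$ then $\mathsf{hd}(t),\mathsf{tl}(t)\in\mathrm{Tm}_{\mathsf{E}}$; if $t\in\mathrm{Tm}_{\mathsf{C}}$ and $s\in\mathrm{Tm}_{\mathsf{E}}$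 then $\mathsf{ind}(t,s)\in\mathrm{Tm}_{\mathsf{C}}$. $\mathrm{Tm}$ is the union of these sets. Formulae are built from a countable set $\mathrm{Prop}$ of propositional variables using $\neg,\wedge,\vee,\to$ and the rule: if $A$ is a formula and $t\in\mathrm{Tm}_\circledast$ then $t{:}_\circledast A$ is a formula. Axioms of $\mathsf{LP}^{\mathsf{C}}_h$ (all instances): (1) propositional tautologies; (2) $t{:}_*(A\to B)\to(s{:}_*A\to (t\cdot s){:}_*B)$; (3) $t{:}_*A\to(t+s){:}_*A$ and $s{:}_*A\to(t+s){:}_*A$; (4) $t{:}_iA\to A$; (5) $t{:}_iA\to (!t){:}_i\, t{:}_iA$; (6) $t_1{:}_1A\wedge\dots\wedge t_h{:}_hA\to\langle t_1,\dots,t_h\rangle{:}_{\mathsf{E}}A$; (7) $t{:}_{\mathsf{E}}A\to (\pi_it){:}_iA$; (8) $t{:}_{\mathsf{C}}A\to\mathsf{hd}(t){:}_{\mathsf{E}}A$ and $t{:}_{\mathsf{C}}A\to\mathsf{tl}(t){:}_{\mathsf{E}}\,t{:}_{\mathsf{C}}A$; (9) $A\wedge t{:}_{\mathsf{C}}(A\to s{:}_{\mathsf{E}}A)\to\mathsf{ind}(t,s){:}_{\mathsf{C}}A$. A constant specification $\mathcal{CS}$ is any set of formulae $c{:}_\circledast A$ with $c\in\mathrm{Cons}_\circledast$ and $A$ an axiom. $\mathsf{LP}^{\mathsf{C}}_h(\mathcal{CS})$ is the Hilbert system with these axioms, modus ponens, and axiom necessitation (derive $c{:}_\circledast A$ whenever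 $c{:}_\circledast A\in\mathcal{CS}$); $\Delta\vdash_{\mathcal{CS}}A$ means $A$ is derivable from assumptions $\Delta$ in it. Canonical model: a set $\Phi$ of formulae is $\mathcal{CS}$-consistent if $\Phi\not\vdash_{\mathcal{CS}}\varphi$ for some formula $\varphi$, and maximal $\mathcal{CS}$-consistent if it is $\mathcal{CS}$-consistent with no $\mathcal{CS}$-consistent proper extension. For a set $\Phi$, $\Phi/\circledast:=\{A:\ t{:}_\circledast A\in\Phi\text{ for some }t\in\mathrm{Tm}_\circledast\}$. The canonical AF-model meeting $\mathcal{CS}$ is $\mathcal{M}=(W,R,\mathcal{E},\nu)$ with $W$ = the set of maximal $\mathcal{CS}$-consistent sets, $R_i=\{(w,v)\in W\times W: w/i\subseteq v\}$, $R_{\mathsf{E}}:=R_1\cup\dots\cup R_h$, $R_{\mathsf{C}}:=\bigcup_{n\ge1}(R_{\mathsf{E}})^n$, $\mathcal{E}_\circledast(w,t)=\{A: t{:}_\circledast A\in w\}$ for $t\in\mathrm{Tm}_\circledast$, $\nu(P)=\{w\in W: P\in w\}$. Satisfaction: $\mathcal{M},w\Vdash P$ iff $w\in\nu(P)$; classical for connectives; $\mathcal{M},w\Vdash t{:}_\circledast A$ iff $A\in\mathcal{E}_\circledast(w,t)$ and $\mathcal{M},v\Vdash A$ for all $v\in W$ with $(w,v)\in R_\circledast$. -}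

module Defs where

open import Level using (Level; Lift; 0ℓ) renaming (suc to lsuc)
open import Data.Nat using (ℕ)
open import Data.Fin using (Fin)
open import Data.Bool using (Bool; true; false; not; _∧_; _∨_)
open import Data.List using (List; allFin)
open import Data.List.Relation.Unary.All using (All)
open import Data.Product using (Σ; _×_; _,_)
open import Data.Sum using (_⊎_)
open import Relation.Nullary using (¬_)
open import Relation.Binary.PropositionalEquality using (_≡_)
open import Relation.Binary.Construct.Closure.Transitive using (TransClosure)

-- Everything is parameterised by the number h of agents.
module LPC (h : ℕ) where

  data Idx : Set where
    ag : Fin h → Idx
    E  : Idx
    C  : Idx

  data Star : Idx → Set where
    ag* : (i : Fin h) → Star (ag i)
    C*  : Star C

  -- Evidence terms, indexed by their sort ⊛.
  -- Constants/variables of sort ⊛ are tagged natural numbers (so the sets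
  -- Cons_⊛, Var_⊛ are countably infinite and pairwise disjoint).
  data Tm : Idx → Set where
    con  : (x : Idx) → ℕ → Tm x
    var  : (x : Idx) → ℕ → Tm x
    !_   : {i : Fin h} → Tm (ag i) → Tm (ag i)
    plus : {x : Idx} → Star x → Tm x → Tm x → Tm x
    app  : {x : Idx} → Star x → Tm x → Tm x → Tm x
    ⟨_⟩  : All (λ i → Tm (ag i)) (allFin h) → Tm E
    π    : (i : Fin h) → Tm E → Tm (ag i)
    hd   : Tm C → Tm E
    tl   : Tm C → Tm E
    ind  : Tm C → Tm E → Tm C

  data Fm : Set where
    atom : ℕ → Fm
    ~_   : Fm → Fm
    _∧'_ : Fm → Fm → Fm
    _∨'_ : Fm → Fm → Fm
    _⇒_  : Fm → Fm → Fm
    jst  : {x : Idx} → Tm x → Fm → Fm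

  -- Propositional tautologies: true under every Boolean assignment to the
  -- propositional atoms and to the (maximal) justification subformulae.
  eval : (ℕ → Bool) → ({x : Idx} → Tm x → Fm → Bool) → Fm → Bool
  eval p j (atom n) = p n
  eval p j (~ A) = not (eval p j A)
  eval p j (A ∧' B) = eval p j A ∧ eval p j B
  eval p j (A ∨' B) = eval p j A ∨ eval p j B
  eval p j (A ⇒ B) = not (eval p j A) ∨ eval p j B
  eval p j (jst t A) = j t A

  Taut : Fm → Set
  Taut A = (p : ℕ → Bool) (j : {x : Idx} → Tm x → Fm → Bool) → eval p j A ≡ true

  -- t₁:₁A ∧ … ∧ t_h:_h A  (right-nested conjunction over the tuple;
  -- for the empty list this would be a tautology, but h ≥ 1 is assumed)
  conjAll : {is : List (Fin h)} → All (λ i → Tm (ag i)) is → Fm → Fm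
  conjAll All.[] A = atom 0 ⇒ atom 0
  conjAll (t All.∷ All.[]) A = jst t A
  conjAll (t All.∷ ts@(_ All.∷ _)) A = jst t A ∧' conjAll ts A


  data Axiom : Fm → Set where
    ax1  : ∀ {A} → Taut A → Axiom A
    ax2  : ∀ {x} (s* : Star x) {t s : Tm x} {A B} →
           Axiom (jst t (A ⇒ B) ⇒ (jst s A ⇒ jst (app s* t s) B))
    ax3l : ∀ {x} (s* : Star x) {t s : Tm x} {A} → Axiom (jst t A ⇒ jst (plus s* t s) A)
    ax3r : ∀ {x} (s* : Star x) {t s : Tm x} {A} → Axiom (jst s A ⇒ jst (plus s* t s) A)
    ax4  : ∀ {i} {t : Tm (ag i)} {A} → Axiom (jst t A ⇒ A)
    ax5  : ∀ {i} {t : Tm (ag i)} {A} → Axiom (jst t A ⇒ jst (! t) (jst t A))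
    ax6  : ∀ {ts : All (λ i → Tm (ag i)) (allFin h)} {A} →
           Axiom (conjAll ts A ⇒ jst ⟨ ts ⟩ A)
    ax7  : ∀ {i} {t : Tm E} {A} → Axiom (jst t A ⇒ jst (π i t) A)
    ax8h : ∀ {t : Tm C} {A} → Axiom (jst t A ⇒ jst (hd t) A)
    ax8t : ∀ {t : Tm C} {A} → Axiom (jst t A ⇒ jst (tl t) (jst t A))
    ax9  : ∀ {t : Tm C} {s : Tm E} {A} →
           Axiom ((A ∧' jst t (A ⇒ jst s A)) ⇒ jst (ind t s) A)

  record CSpec : Set₁ where
    field
      mem   : (x : Idx) → ℕ → Fm → Set
      isAx  : ∀ {x c A} → mem x c A → Axiom A

  module _ (CS : CSpec) where
    open CSpec CS

    data _⊢_ (Δ : Fm → Set) : Fm → Set where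
      hyp : ∀ {A} → Δ A → Δ ⊢ A
      ax  : ∀ {A} → Axiom A → Δ ⊢ A
      mp  : ∀ {A B} → Δ ⊢ (A ⇒ B) → Δ ⊢ A → Δ ⊢ B
      nec : ∀ {x c A} → mem x c A → Δ ⊢ jst (con x c) A

    _⊆_ : (Fm → Set) → (Fm → Set) → Set
    Φ ⊆ Ψ = ∀ {A} → Φ A → Ψ A

    Consistent : (Fm → Set) → Set
    Consistent Φ = Σ Fm (λ φ → ¬ (Φ ⊢ φ))

    MaxConsistent : (Fm → Set) → Set₁
    MaxConsistent Φ = Consistent Φ ×
      ((Ψ : Fm → Set) → Φ ⊆ Ψ → Consistent Ψ → Ψ ⊆ Φ)

    World : Set₁
    World = Σ (Fm → Set) MaxConsistent

    _∋_ : World → Fm → Set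
    (w , _) ∋ A = w A

    _/_ : World → Idx → Fm → Set
    (w / x) A = Σ (Tm x) (λ t → w ∋ jst t A)

    Ri : Fin h → World → World → Set
    Ri i w v = ∀ {A} → (w / ag i) A → v ∋ A

    RE : World → World → Set
    RE w v = Σ (Fin h) (λ i → Ri i w v)

    R : Idx → World → World → Set₁
    R (ag i) w v = Lift (lsuc 0ℓ) (Ri i w v)
    R E w v = Lift (lsuc 0ℓ) (RE w v)
    R C w v = TransClosure RE w v

    ℰ : World → {x : Idx} → Tm x → Fm → Set
    ℰ w t A = w ∋ jst t A

    ν : ℕ → World → Set
    ν P w = w ∋ atom P

    _⊩_ : World → Fm → Set₁
    w ⊩ atom P = Lift (lsuc 0ℓ) (ν P w)
    w ⊩ (~ A) = ¬ (w ⊩ A)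
    w ⊩ (A ∧' B) = (w ⊩ A) × (w ⊩ B)
    w ⊩ (A ∨' B) = (w ⊩ A) ⊎ (w ⊩ B)
    w ⊩ (A ⇒ B) = w ⊩ A → w ⊩ B
    w ⊩ jst {x} t A = Lift (lsuc 0ℓ) (ℰ w t A) × ((v : World) → R x w v → v ⊩ A)

module Submission where

-- A maximal consistent set is deductively closed and, classically, contains
-- exactly one of A and ~A; hence membership commutes with the propositional
-- connectives.  For t :_⊛ A, membership is exactly the evidence condition, and
-- A lies in every R_⊛-successor: directly for agents, through π_i (axiom 7) for
-- E, and along an E-path for C using axiom 8.  Induction on A then identifies
-- membership with satisfaction.

open import Defs
open import Level using (Lift; lift; lower) renaming (suc to lsuc)
open import Data.Nat using (ℕ; _≤_)
open import Data.Bool using (Bool; true; false; not; _∧_; _∨_)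
open import Data.Product using (_×_; _,_; proj₁; proj₂)
open import Data.Product.Function.NonDependent.Propositional using (_×-⇔_)
open import Data.Sum using (_⊎_; inj₁; inj₂)
open import Data.Sum.Function.Propositional using (_⊎-⇔_)
open import Data.Empty using (⊥-elim)
open import Function.Base using (_∘_)
open import Function.Bundles using (_⇔_; mk⇔; Equivalence)
open import Function.Construct.Composition using (_⇔-∘_)
open import Function.Related.TypeIsomorphisms using (¬-cong-⇔; →-cong-⇔)
open import Relation.Nullary using (¬_; Dec; yes; no)
open import Relation.Nullary.Decidable using (map′)
open import Relation.Binary.PropositionalEquality using (_≡_; refl)
open import Relation.Binary.Construct.Closure.Transitive using (TransClosure; [_]; _∷_)
open import Axiom.ExcludedMiddle using (ExcludedMiddle)

open Equivalence using (to; from)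

truth-table₁ : (f : Bool → Bool) → f true ≡ true → f false ≡ true → ∀ a → f a ≡ true
truth-table₁ f t _ true  = t
truth-table₁ f _ e false = e

truth-table₂ : (f : Bool → Bool → Bool) →
  f true true ≡ true → f true false ≡ true → f false true ≡ true → f false false ≡ true →
  ∀ a b → f a b ≡ true
truth-table₂ f p q _ _ true  = truth-table₁ (f true) p q
truth-table₂ f _ _ r s false = truth-table₁ (f false) r s

truth-table₃ : (f : Bool → Bool → Bool → Bool) →
  f true true true ≡ true → f true true false ≡ true →
  f true false true ≡ true → f true false false ≡ true →
  f false true true ≡ true → f false true false ≡ true →
  f false false true ≡ true → f false false false ≡ true →
  ∀ a b c → f a b c ≡ true
truth-table₃ f p q r s _ _ _ _ true  = truth-table₂ (f true) p q r s
truth-table₃ f _ _ _ _ p q r s false = truth-table₂ (f false) p q r s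

module Tautologies (h : ℕ) where
  open LPC h

  K : ∀ {A B} → Axiom (A ⇒ (B ⇒ A))
  K {A} {B} = ax1 λ p j →
    truth-table₂ (λ a b → not a ∨ (not b ∨ a)) refl refl refl refl (eval p j A) (eval p j B)

  S : ∀ {A B D} → Axiom ((A ⇒ (B ⇒ D)) ⇒ ((A ⇒ B) ⇒ (A ⇒ D)))
  S {A} {B} {D} = ax1 λ p j →
    truth-table₃ (λ a b c → not (not a ∨ (not b ∨ c)) ∨ (not (not a ∨ b) ∨ (not a ∨ c)))
      refl refl refl refl refl refl refl refl (eval p j A) (eval p j B) (eval p j D)

  I : ∀ {A} → Axiom (A ⇒ A)
  I {A} = ax1 λ p j → truth-table₁ (λ a → not a ∨ a) refl refl (eval p j A)

  ~-intro : ∀ {A} → Axiom ((A ⇒ (~ A)) ⇒ (~ A))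
  ~-intro {A} = ax1 λ p j →
    truth-table₁ (λ a → not (not a ∨ not a) ∨ not a) refl refl (eval p j A)

  ~-elim : ∀ {A B} → Axiom (A ⇒ ((~ A) ⇒ B))
  ~-elim {A} {B} = ax1 λ p j →
    truth-table₂ (λ a b → not a ∨ (not (not a) ∨ b)) refl refl refl refl (eval p j A) (eval p j B)

  ∧-elimˡ : ∀ {A B} → Axiom ((A ∧' B) ⇒ A)
  ∧-elimˡ {A} {B} = ax1 λ p j →
    truth-table₂ (λ a b → not (a ∧ b) ∨ a) refl refl refl refl (eval p j A) (eval p j B)

  ∧-elimʳ : ∀ {A B} → Axiom ((A ∧' B) ⇒ B)
  ∧-elimʳ {A} {B} = ax1 λ p j →
    truth-table₂ (λ a b → not (a ∧ b) ∨ b) refl refl refl refl (eval p j A) (eval p j B)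

  ∧-intro : ∀ {A B} → Axiom (A ⇒ (B ⇒ (A ∧' B)))
  ∧-intro {A} {B} = ax1 λ p j →
    truth-table₂ (λ a b → not a ∨ (not b ∨ (a ∧ b))) refl refl refl refl (eval p j A) (eval p j B)

  ∨-introˡ : ∀ {A B} → Axiom (A ⇒ (A ∨' B))
  ∨-introˡ {A} {B} = ax1 λ p j →
    truth-table₂ (λ a b → not a ∨ (a ∨ b)) refl refl refl refl (eval p j A) (eval p j B)

  ∨-introʳ : ∀ {A B} → Axiom (B ⇒ (A ∨' B))
  ∨-introʳ {A} {B} = ax1 λ p j →
    truth-table₂ (λ a b → not b ∨ (a ∨ b)) refl refl refl refl (eval p j A) (eval p j B)

  disjunctive-syllogism : ∀ {A B} → Axiom ((A ∨' B) ⇒ ((~ A) ⇒ B))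
  disjunctive-syllogism {A} {B} = ax1 λ p j →
    truth-table₂ (λ a b → not (a ∨ b) ∨ (not (not a) ∨ b)) refl refl refl refl
      (eval p j A) (eval p j B)

  ex-falso : ∀ {A B} → Axiom ((~ A) ⇒ (A ⇒ B))
  ex-falso {A} {B} = ax1 λ p j →
    truth-table₂ (λ a b → not (not a) ∨ (not a ∨ b)) refl refl refl refl (eval p j A) (eval p j B)

module CanonicalModel (h : ℕ) (CS : LPC.CSpec h) where
  open LPC h hiding (_⊢_; World; _∋_; _⊩_; R)
  open Tautologies h

  _⊢_ : (Fm → Set) → Fm → Set
  _⊢_ = LPC._⊢_ h CS

  World : Set₁
  World = LPC.World h CS

  _∋_ : World → Fm → Set
  _∋_ = LPC._∋_ h CS

  _⊩_ : World → Fm → Set₁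
  _⊩_ = LPC._⊩_ h CS

  R : Idx → World → World → Set₁
  R = LPC.R h CS

  _▸_ : (Fm → Set) → Fm → Fm → Set
  (Δ ▸ A) B = Δ B ⊎ B ≡ A

  deduction : ∀ {Δ A B} → (Δ ▸ A) ⊢ B → Δ ⊢ (A ⇒ B)
  deduction (hyp (inj₁ b)) = mp (ax K) (hyp b)
  deduction (hyp (inj₂ refl)) = ax I
  deduction (ax a) = mp (ax K) (ax a)
  deduction (mp d e) = mp (mp (ax S) (deduction d)) (deduction e)
  deduction (nec c) = mp (ax K) (nec c)

  cut : ∀ {Δ A B} → Δ ⊢ A → (Δ ▸ A) ⊢ B → Δ ⊢ B
  cut d e = mp (deduction e) d

  module _ (w : World) where
    private
      Φ = proj₁ w

    ∋-maximal : ∀ {A} → Consistent CS (Φ ▸ A) → w ∋ A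
    ∋-maximal {A} consistent = proj₂ (proj₂ w) (Φ ▸ A) inj₁ consistent (inj₂ refl)

    ∋-closed : ∀ {A} → Φ ⊢ A → w ∋ A
    ∋-closed d = let (φ , ⊬φ) = proj₁ (proj₂ w) in ∋-maximal (φ , ⊬φ ∘ cut d)

    ∋-ax : ∀ {A} → Axiom A → w ∋ A
    ∋-ax = ∋-closed ∘ ax

    ∋-mp : ∀ {A B} → w ∋ (A ⇒ B) → w ∋ A → w ∋ B
    ∋-mp p q = ∋-closed (mp (hyp p) (hyp q))

    ∋-∧ : ∀ {A B} → w ∋ (A ∧' B) ⇔ (w ∋ A × w ∋ B)
    ∋-∧ = mk⇔ (λ p → ∋-mp (∋-ax ∧-elimˡ) p , ∋-mp (∋-ax ∧-elimʳ) p)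
              (λ (a , b) → ∋-mp (∋-mp (∋-ax ∧-intro) a) b)

  ∋-jst-E : ∀ w v {s : Tm E} {A} → RE CS w v → w ∋ jst s A → v ∋ A
  ∋-jst-E w v {s} (i , w/i⊆v) p = w/i⊆v (π i s , ∋-mp w (∋-ax w ax7) p)

  -- tl(t) carries t :_C A along every E-step of the path; hd(t) delivers A at its end.
  ∋-jst-C : ∀ {w v} {t : Tm C} {A} → TransClosure (RE CS) w v → w ∋ jst t A → v ∋ A
  ∋-jst-C {w} {v} [ step ] p = ∋-jst-E w v step (∋-mp w (∋-ax w ax8h) p)
  ∋-jst-C {w} (_∷_ {y = u} step path) p =
    ∋-jst-C path (∋-jst-E w u step (∋-mp w (∋-ax w ax8t) p))

  ∋-jst-R : ∀ x {t : Tm x} {A w v} → R x w v → w ∋ jst t A → v ∋ A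
  ∋-jst-R (ag i) {t} (lift w/i⊆v) p = w/i⊆v (t , p)
  ∋-jst-R E {w = w} {v} (lift step) = ∋-jst-E w v step
  ∋-jst-R C path = ∋-jst-C path

  module Classical (em : ExcludedMiddle (lsuc Level.zero)) where

    decide : (P : Set) → Dec P
    decide P = map′ lower lift em

    module _ (w : World) where
      private
        Φ = proj₁ w

      ∋-~ : ∀ {A} → w ∋ (~ A) ⇔ (¬ w ∋ A)
      ∋-~ {A} = mk⇔ refute complete
        where
          refute : w ∋ (~ A) → ¬ w ∋ A
          refute ~a a = proj₂ (proj₁ (proj₂ w)) (mp (mp (ax ~-elim) (hyp a)) (hyp ~a))

          complete : ¬ w ∋ A → w ∋ (~ A)
          complete ¬a with decide ((Φ ▸ A) ⊢ (~ A))
          ... | yes d  = ∋-closed w (mp (ax ~-intro) (deduction d))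
          ... | no ⊬~a = ⊥-elim (¬a (∋-maximal w (~ A , ⊬~a)))

      ∋-∨ : ∀ {A B} → w ∋ (A ∨' B) ⇔ (w ∋ A ⊎ w ∋ B)
      ∋-∨ {A} {B} = mk⇔ split join
        where
          split : w ∋ (A ∨' B) → w ∋ A ⊎ w ∋ B
          split p with decide (w ∋ A)
          ... | yes a = inj₁ a
          ... | no ¬a = inj₂ (∋-mp w (∋-mp w (∋-ax w disjunctive-syllogism) p) (from ∋-~ ¬a))

          join : w ∋ A ⊎ w ∋ B → w ∋ (A ∨' B)
          join (inj₁ a) = ∋-mp w (∋-ax w ∨-introˡ) a
          join (inj₂ b) = ∋-mp w (∋-ax w ∨-introʳ) b

      ∋-⇒ : ∀ {A B} → w ∋ (A ⇒ B) ⇔ (w ∋ A → w ∋ B)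
      ∋-⇒ {A} {B} = mk⇔ (∋-mp w) internalise
        where
          internalise : (w ∋ A → w ∋ B) → w ∋ (A ⇒ B)
          internalise f with decide (w ∋ A)
          ... | yes a = ∋-mp w (∋-ax w K) (f a)
          ... | no ¬a = ∋-mp w (∋-ax w ex-falso) (from ∋-~ ¬a)

    ∋⇔⊩ : ∀ A w → w ∋ A ⇔ w ⊩ A
    ∋⇔⊩ (atom n) w = mk⇔ lift lower
    ∋⇔⊩ (~ A) w = ¬-cong-⇔ (∋⇔⊩ A w) ⇔-∘ ∋-~ w
    ∋⇔⊩ (A ∧' B) w = (∋⇔⊩ A w ×-⇔ ∋⇔⊩ B w) ⇔-∘ ∋-∧ w
    ∋⇔⊩ (A ∨' B) w = (∋⇔⊩ A w ⊎-⇔ ∋⇔⊩ B w) ⇔-∘ ∋-∨ w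
    ∋⇔⊩ (A ⇒ B) w = →-cong-⇔ (∋⇔⊩ A w) (∋⇔⊩ B w) ⇔-∘ ∋-⇒ w
    ∋⇔⊩ (jst {x} t A) w =
      mk⇔ (λ p → lift p , λ v r → to (∋⇔⊩ A v) (∋-jst-R x r p)) (lower ∘ proj₁)

-- The truth lemma holds for every h.
lemma10 : ExcludedMiddle (lsuc Level.zero) → (h : ℕ) → 1 ≤ h → (CS : LPC.CSpec h) →
    (A : LPC.Fm h) → (w : LPC.World h CS) →
    (LPC._∋_ h CS w A) ⇔ (LPC._⊩_ h CS w A)
lemma10 em h _ CS = CanonicalModel.Classical.∋⇔⊩ h CS em
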